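{- For every $\mathrm{NWTL}$ formula $\phi$ there exists a first-order formula $\alpha_\phi(x)$ using at most three variables $x,y,z$ such that for every nested word $\bar w$ (finite or infinite) and every position $i$ of $\bar w$, $(\bar w,i)\models\phi$ iff $\bar w\models\alpha_\phi(i)$.
   Context: Let $\Sigma$ be a finite alphabet. A matching on $\mathbb{N}$ or on an interval $[1,n]$ consists of a binary relation $\mu$ and unary relations $\mathit{call},\mathit{ret}$ such that: (1) if $\mu(i,j)$ then $\mathit{call}(i)$, $\mathit{ret}(j)$ and $i<j$; (2) if $\mu(i,j)$ and $\mu(i,j')$ then $j=j'$, and if $\mu(i,j)$ and $\mu(i',j)$ then $i=i'$; (3) if $i\le j$, $\mathit{call}(i)$ and $\mathit{ret}(j)$, then there is $k$ with $i\le k\le j$ such that $\mu(i,k)$ or $\mu(k,j)$. A finite nested word of length $n$ is $\bar w=(w,\mu,\mathit{call},\mathit{ret})$ with $w=a_1\cdots a_n\in\Sigma^*$ and a matching on $[1,n]$; a nested $\omega$-word is the same with $w\in\Sigma^\omega$ and a matching on $\mathbb{N}$. If $\mu(i,j)$, $i$ is a matched call and we write $r(i)=j$. A nested word is identified with the structure $\langle U,(P_a)_{a\in\Sigma},<,\mu,\mathit{call},\mathit{ret}\rangle$ ($U=\{1,\dots,n\}$ or $\mathbb{N}$, $P_a$ = positions labelled $a$); first-order formulas are over this vocabulary. A summary path between positions $i\le j$ is the sequence $i=i_0<\dots<i_k=j$ where, for $p<k$, $i_{p+1}=r(i_p)$ if $i_p$ is a matched call with $r(i_p)\le j$, and $i_{p+1}=i_p+1$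 otherwise. $\mathrm{NWTL}$ formulas: $\top\mid a\ (a\in\Sigma)\mid \mathit{call}\mid\mathit{ret}\mid\neg\phi\mid\phi\vee\phi'\mid\bigcirc\phi\mid\bigcirc_\mu\phi\mid\ominus\phi\mid\ominus_\mu\phi\mid\phi\,\mathbf{U}^\sigma\phi'\mid\phi\,\mathbf{S}^\sigma\phi'$, with semantics at position $i$: $a$ iff $i$ labelled $a$; $\mathit{call}$/$\mathit{ret}$ iff $\mathit{call}(i)$/$\mathit{ret}(i)$; Booleans as usual; $\bigcirc\phi$ iff $\phi$ at $i+1$; $\bigcirc_\mu\phi$ iff $\mu(i,j)$ for some $j$ with $\phi$ at $j$; $\ominus\phi$ iff $i>1$ and $\phi$ at $i-1$; $\ominus_\mu\phi$ iff $\mu(j,i)$ for some $j$ with $\phi$ at $j$; $\phi\,\mathbf{U}^\sigma\psi$ iff for some $j\ge i$, with summary path $i=i_0<\dots<i_k=j$, $\psi$ holds at $j$ and $\phi$ at all $i_p$, $p<k$; $\phi\,\mathbf{S}^\sigma\psi$ iff for some $j\le i$, with summary path $j=i_0<\dots<i_k=i$, $\psi$ holds at $j$ and $\phi$ at all $i_p$, $0<p\le k$. -}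

module Defs where

open import Level using (0ℓ)
open import Data.Nat using (ℕ; zero; suc; _≤_; _<_; _∸_)
open import Data.Fin using (Fin; _≟_)
open import Data.Product using (Σ; _×_; _,_)
open import Data.Sum using (_⊎_)
open import Data.Empty using (⊥)
open import Relation.Nullary using (¬_; yes; no)
open import Relation.Binary.PropositionalEquality using (_≡_)

-- Nested words (finite or infinite) over the finite alphabet Fin k.
-- Positions are 1-based: a finite nested word of length n has positions
-- 1..n, an infinite one has positions 1,2,3,...

data Length : Set where
  fin : ℕ → Length
  inf : Length

InDom : Length → ℕ → Set
InDom (fin n) i = (1 ≤ i) × (i ≤ n)
InDom inf     i = 1 ≤ i

record NestedWord (k : ℕ) : Set₁ where
  field
    len   : Length
    label : ℕ → Fin k              -- only values on the domain matter
    μ     : ℕ → ℕ → Set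
    call  : ℕ → Set
    ret   : ℕ → Set
    μ-dom    : ∀ {i j} → μ i j → InDom len i × InDom len j
    call-dom : ∀ {i} → call i → InDom len i
    ret-dom  : ∀ {i} → ret i → InDom len i
    μ-call : ∀ {i j} → μ i j → call i
    μ-ret  : ∀ {i j} → μ i j → ret j
    μ-<    : ∀ {i j} → μ i j → i < j
    μ-funˡ : ∀ {i j j'} → μ i j → μ i j' → j ≡ j'
    μ-funʳ : ∀ {i i' j} → μ i j → μ i' j → i ≡ i'
    μ-nest : ∀ {i j} → i ≤ j → call i → ret j →
             Σ ℕ (λ m → (i ≤ m) × (m ≤ j) × (μ i m ⊎ μ m j))

open NestedWord public

Pos : ∀ {k} → NestedWord k → ℕ → Set
Pos w = InDom (len w)

data SumStep {k} (w : NestedWord k) (j : ℕ) : ℕ → ℕ → Set where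
  step-μ   : ∀ {p q} → μ w p q → q ≤ j → SumStep w j p q
  step-suc : ∀ {p} → ¬ (Σ ℕ (λ q → μ w p q × (q ≤ j))) → SumStep w j p (suc p)

-- UPath w P j p : the summary path p = i₀ < … < i_m = j exists and
-- P holds at every i_t with t < m.
data UPath {k} (w : NestedWord k) (P : ℕ → Set) (j : ℕ) : ℕ → Set where
  u-done : UPath w P j j
  u-step : ∀ {p p'} → p < j → P p → SumStep w j p p' → UPath w P j p' → UPath w P j p

-- SPath w P i p : the summary path p = i₀ < … < i_m = i exists and
-- P holds at every i_t with 0 < t ≤ m.
data SPath {k} (w : NestedWord k) (P : ℕ → Set) (i : ℕ) : ℕ → Set where
  s-done : SPath w P i i
  s-step : ∀ {p p'} → p < i → SumStep w i p p' → P p' → SPath w P i p' → SPath w P i p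

data NWTL (k : ℕ) : Set where
  ⊤'     : NWTL k
  lab    : Fin k → NWTL k
  callF  : NWTL k
  retF   : NWTL k
  ¬'_    : NWTL k → NWTL k
  _∨'_   : NWTL k → NWTL k → NWTL k
  ○_     : NWTL k → NWTL k
  ○μ_    : NWTL k → NWTL k
  ⊖_     : NWTL k → NWTL k
  ⊖μ_    : NWTL k → NWTL k
  _U_    : NWTL k → NWTL k → NWTL k
  _S_    : NWTL k → NWTL k → NWTL k

_,_⊨_ : ∀ {k} → NestedWord k → ℕ → NWTL k → Set
w , i ⊨ ⊤'      = Data.Unit.⊤ where import Data.Unit
w , i ⊨ lab a   = label w i ≡ a
w , i ⊨ callF   = call w i
w , i ⊨ retF    = ret w i
w , i ⊨ (¬' φ)  = ¬ (w , i ⊨ φ)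
w , i ⊨ (φ ∨' ψ) = (w , i ⊨ φ) ⊎ (w , i ⊨ ψ)
w , i ⊨ (○ φ)   = Pos w (suc i) × (w , suc i ⊨ φ)
w , i ⊨ (○μ φ)  = Σ ℕ (λ j → μ w i j × (w , j ⊨ φ))
w , i ⊨ (⊖ φ)   = (1 < i) × (w , i ∸ 1 ⊨ φ)
w , i ⊨ (⊖μ φ)  = Σ ℕ (λ j → μ w j i × (w , j ⊨ φ))
w , i ⊨ (φ U ψ) = Σ ℕ (λ j → (i ≤ j) × Pos w j × (w , j ⊨ ψ) × UPath w (λ p → w , p ⊨ φ) j i)
w , i ⊨ (φ S ψ) = Σ ℕ (λ j → (j ≤ i) × Pos w j × (w , j ⊨ ψ) × SPath w (λ p → w , p ⊨ φ) i j)

Var : Set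
Var = Fin 3

x y z : Var
x = Fin.zero where import Data.Fin as Fin
y = Fin.suc Fin.zero where import Data.Fin as Fin
z = Fin.suc (Fin.suc Fin.zero) where import Data.Fin as Fin

data FO3 (k : ℕ) : Set where
  P     : Fin k → Var → FO3 k
  _≐_   : Var → Var → FO3 k
  _≺_   : Var → Var → FO3 k
  μ'    : Var → Var → FO3 k
  call' : Var → FO3 k
  ret'  : Var → FO3 k
  ¬ᶠ_   : FO3 k → FO3 k
  _∨ᶠ_  : FO3 k → FO3 k → FO3 k
  ∃ᶠ    : Var → FO3 k → FO3 k

Env : Set
Env = Var → ℕ

_[_≔_] : Env → Var → ℕ → Env
(ρ [ v ≔ m ]) u with u ≟ v
... | yes _ = m
... | no  _ = ρ u

_⊨ᶠ_[_] : ∀ {k} → NestedWord k → FO3 k → Env → Set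
w ⊨ᶠ P a v [ ρ ]      = label w (ρ v) ≡ a
w ⊨ᶠ (u ≐ v) [ ρ ]    = ρ u ≡ ρ v
w ⊨ᶠ (u ≺ v) [ ρ ]    = ρ u < ρ v
w ⊨ᶠ μ' u v [ ρ ]     = μ w (ρ u) (ρ v)
w ⊨ᶠ call' v [ ρ ]    = call w (ρ v)
w ⊨ᶠ ret' v [ ρ ]     = ret w (ρ v)
w ⊨ᶠ (¬ᶠ α) [ ρ ]     = ¬ (w ⊨ᶠ α [ ρ ])
w ⊨ᶠ (α ∨ᶠ β) [ ρ ]   = (w ⊨ᶠ α [ ρ ]) ⊎ (w ⊨ᶠ β [ ρ ])
w ⊨ᶠ ∃ᶠ v α [ ρ ]     = Σ ℕ (λ m → Pos w m × (w ⊨ᶠ α [ ρ [ v ≔ m ] ]))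

module Submission where

-- The formula α_φ = tr φ is defined by recursion on φ; its only free
-- variable is x, and a subformula is re-used at y or z by swapping variable
-- names ('ren'), so three variables suffice.  The one non-local ingredient
-- is the shape of summary paths (upath-char, spath-char): for i ≤ j, a
-- position m ∈ [i, j] is a node of the summary path from i to j iff it is
-- not Covered, i.e. no matched pair c ↦ r has i ≤ c < m < r ≤ j.  Because
-- matched pairs do not cross, Covered splits (covered-split) into a pending
-- call in [i, m) and a pending return in (m, j], each an FO³ formula that
-- reuses the third variable.

open import Defs
open import Level using (0ℓ)
open import Axiom.ExcludedMiddle using (ExcludedMiddle)
open import Axiom.DoubleNegationElimination using (em⇒dne)
open import Data.Nat using (>-nonZero; ℕ; zero; suc; _≤_; _<_; _+_; _∸_; z≤n; s≤s; _<?_; _≤?_)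
open import Data.Nat.Properties
  using (≤-refl; ≤-trans; ≤-reflexive; ≤-antisym; <⇒≤; <-trans; <-irrefl; <⇒≱; ≮⇒≥; ≰⇒>;
         <-cmp; m≤n⇒m<n∨m≡n; +-suc; +-monoʳ-≤; m≤m+n; m∸n≤m; ∸-monoˡ-≤; suc-pred)
open import Data.Fin using (Fin; _≟_)
open import Data.Fin.Permutation.Components using (transpose; transpose-inverse)
open import Data.Product using (Σ; _×_; _,_; proj₁; proj₂)
open import Data.Product.Function.NonDependent.Propositional using (_×-⇔_)
open import Data.Sum using (_⊎_; inj₁; inj₂; [_,_])
open import Data.Sum.Function.Propositional using (_⊎-⇔_)
open import Data.Empty using (⊥-elim)
open import Data.Unit using (tt)
open import Function using (_∘_)
open import Function.Bundles using (_⇔_; mk⇔; Equivalence)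
open import Function.Construct.Composition using (_⇔-∘_)
open import Function.Construct.Identity using (⇔-id)
open import Function.Construct.Symmetry using (⇔-sym)
open import Function.Definitions using (Injective)
open import Function.Related.TypeIsomorphisms using (¬-cong-⇔)
open import Relation.Nullary using (¬_; yes; no)
open import Relation.Binary using (tri<; tri≈; tri>)
open import Relation.Binary.PropositionalEquality
  using (_≡_; refl; sym; trans; cong; subst; subst₂)

open Equivalence using (to; from)

EM : Set₁
EM = ExcludedMiddle 0ℓ

-- FO³ has only ¬, ∨, ∃; classically the encodings of ∧, ⇒ and bounded ∀
-- mean what they should.
module Classical (em : EM) where

  ∧-classical : {A B : Set} → (¬ (¬ A ⊎ ¬ B)) ⇔ (A × B)
  ∧-classical = mk⇔ (λ h → em⇒dne em (h ∘ inj₁) , em⇒dne em (h ∘ inj₂))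
                    (λ { (a , b) (inj₁ na) → na a ; (a , b) (inj₂ nb) → nb b })

  ⇒-classical : {A B : Set} → (¬ A ⊎ B) ⇔ (A → B)
  ⇒-classical {A} {B} = mk⇔ (λ { (inj₁ na) a → ⊥-elim (na a) ; (inj₂ b) _ → b }) decide
    where
    decide : (A → B) → ¬ A ⊎ B
    decide f with em {A}
    ... | yes a = inj₂ (f a)
    ... | no na = inj₁ na

  ∀-classical : {I : Set} {D Q : I → Set} → (¬ Σ I (λ m → D m × ¬ Q m)) ⇔ (∀ m → D m → Q m)
  ∀-classical = mk⇔ (λ h m d → em⇒dne em (λ nq → h (m , d , nq)))
                    (λ f (m , d , nq) → nq (f m d))

pos-≥1 : ∀ L {i} → InDom L i → 1 ≤ i
pos-≥1 (fin n) (1≤i , _) = 1≤i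
pos-≥1 inf 1≤i = 1≤i

pos-below : ∀ {L j m} → InDom L j → 1 ≤ m → m ≤ j → InDom L m
pos-below {fin n} (_ , j≤n) 1≤m m≤j = 1≤m , ≤-trans m≤j j≤n
pos-below {inf} _ 1≤m _ = 1≤m

module Nesting {k} (w : NestedWord k) where

  no-crossing : ∀ {c r c' r'} → μ w c r → μ w c' r' → c < c' → c' < r → r' < r
  no-crossing {c} {r} {c'} {r'} mcr mcr' c<c' c'<r with <-cmp r' r
  ... | tri< r'<r _ _ = r'<r
  ... | tri≈ _ refl _ = ⊥-elim (<-irrefl (μ-funʳ w mcr mcr') c<c')
  ... | tri> _ _ r<r' with μ-nest w (<⇒≤ c'<r) (μ-call w mcr') (μ-ret w mcr)
  ...   | m , _ , m≤r , inj₁ mc'm = ⊥-elim (<⇒≱ r<r' (subst (_≤ r) (μ-funˡ w mc'm mcr') m≤r))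
  ...   | m , c'≤m , _ , inj₂ mmr = ⊥-elim (<⇒≱ c<c' (subst (c' ≤_) (μ-funʳ w mmr mcr) c'≤m))

  Covered : ℕ → ℕ → ℕ → Set
  Covered i m j = Σ ℕ (λ c → (i ≤ c) × (c < m) × Σ ℕ (λ r → μ w c r × (m < r) × (r ≤ j)))

  PendingCall : ℕ → ℕ → Set
  PendingCall i m = Σ ℕ (λ c → (i ≤ c) × (c < m) × Σ ℕ (λ r → μ w c r × (m < r)))

  PendingReturn : ℕ → ℕ → Set
  PendingReturn m j = Σ ℕ (λ r → (m < r) × (r ≤ j) × Σ ℕ (λ c → μ w c r × (c < m)))

  -- Coveredness splits into two conditions on one side of m each; the
  -- nontrivial direction takes the innermost of the two pairs, using
  -- non-crossing.
  covered-split : ∀ {i m j} → Covered i m j ⇔ (PendingCall i m × PendingReturn m j)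
  covered-split = mk⇔ split join
    where
    split : ∀ {i m j} → Covered i m j → PendingCall i m × PendingReturn m j
    split (c , i≤c , c<m , r , mcr , m<r , r≤j) = (c , i≤c , c<m , r , mcr , m<r) , (r , m<r , r≤j , c , mcr , c<m)
    join : ∀ {i m j} → PendingCall i m × PendingReturn m j → Covered i m j
    join ((c₁ , i≤c₁ , c₁<m , r₁ , mcr₁ , m<r₁) , (r₂ , m<r₂ , r₂≤j , c₂ , mcr₂ , c₂<m)) with <-cmp c₁ c₂
    ... | tri< c₁<c₂ _ _ = c₂ , ≤-trans i≤c₁ (<⇒≤ c₁<c₂) , c₂<m , r₂ , mcr₂ , m<r₂ , r₂≤j
    ... | tri≈ _ refl _ = c₂ , i≤c₁ , c₂<m , r₂ , mcr₂ , m<r₂ , r₂≤j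
    ... | tri> _ _ c₂<c₁ = c₁ , i≤c₁ , c₁<m , r₁ , mcr₁ , m<r₁ ,
            <⇒≤ (≤-trans (no-crossing mcr₂ mcr₁ c₂<c₁ (<-trans c₁<m m<r₂)) r₂≤j)

  covered-weaken : ∀ {i i' m j} → i ≤ i' → Covered i' m j → Covered i m j
  covered-weaken i≤i' (c , i'≤c , rest) = c , ≤-trans i≤i' i'≤c , rest

  not-covered-self : ∀ {i j} → ¬ Covered i i j
  not-covered-self (c , i≤c , c<i , _) = <⇒≱ c<i i≤c

  step-< : ∀ {j p p'} → SumStep w j p p' → p < p'
  step-< (step-μ mpq _) = μ-< w mpq
  step-< (step-suc _)   = ≤-refl

  step-≤ : ∀ {j p p'} → SumStep w j p p' → p < j → p' ≤ j
  step-≤ (step-μ _ q≤j) _ = q≤j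
  step-≤ (step-suc _) p<j = p<j

  step-skips : ∀ {j p p' m} → SumStep w j p p' → p < m → m < p' → Covered p m j
  step-skips (step-μ mpq q≤j) p<m m<q = _ , ≤-refl , p<m , _ , mpq , m<q , q≤j
  step-skips (step-suc _) p<m m<sp = ⊥-elim (<⇒≱ m<sp p<m)

  step-shift : ∀ {j p p' m} → SumStep w j p p' → p' ≤ m → Covered p m j → Covered p' m j
  step-shift {m = m} (step-μ {p} {q} mpq _) q≤m (c , p≤c , c<m , r , mcr , m<r , r≤j)
    with m≤n⇒m<n∨m≡n p≤c
  ... | inj₂ refl = ⊥-elim (<⇒≱ m<r (subst (_≤ m) (μ-funˡ w mpq mcr) q≤m))
  ... | inj₁ p<c with q ≤? c
  ...   | yes q≤c = c , q≤c , c<m , r , mcr , m<r , r≤j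
  ...   | no q≰c = ⊥-elim (<⇒≱ (no-crossing mpq mcr p<c (≰⇒> q≰c)) (≤-trans q≤m (<⇒≤ m<r)))
  step-shift (step-suc no-return) _ (c , p≤c , c<m , r , mcr , m<r , r≤j) with m≤n⇒m<n∨m≡n p≤c
  ... | inj₁ p<c = c , p<c , c<m , r , mcr , m<r , r≤j
  ... | inj₂ refl = ⊥-elim (no-return (r , mcr , r≤j))

  next-step : EM → ∀ j p → Σ ℕ (SumStep w j p)
  next-step em j p with em {Σ ℕ (λ q → μ w p q × (q ≤ j))}
  ... | yes (q , mpq , q≤j) = q , step-μ mpq q≤j
  ... | no no-return        = suc p , step-suc no-return

  -- m is a node of the summary path from i to j other than its last one …
  OnUPath : ℕ → ℕ → ℕ → Set
  OnUPath i j m = (i ≤ m) × (m < j) × ¬ Covered i m j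

  -- … respectively other than its first one.
  OnSPath : ℕ → ℕ → ℕ → Set
  OnSPath j i m = (j < m) × (m ≤ i) × ¬ Covered j m i

  module _ (P : ℕ → Set) where

    -- Every uncovered m ∈ [i, j) is a node of the path, so P holds there …
    upath-sound : ∀ {i j} → UPath w P j i → ∀ m → OnUPath i j m → P m
    upath-sound u-done m (i≤m , m<i , _) = ⊥-elim (<⇒≱ m<i i≤m)
    upath-sound (u-step {p} {p'} p<j Pp st rest) m (p≤m , m<j , uncovered) with m≤n⇒m<n∨m≡n p≤m
    ... | inj₂ refl = Pp
    ... | inj₁ p<m with m <? p'
    ...   | yes m<p' = ⊥-elim (uncovered (step-skips st p<m m<p'))
    ...   | no m≮p' = upath-sound rest m
                        (≮⇒≥ m≮p' , m<j , uncovered ∘ covered-weaken (<⇒≤ (step-< st)))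

    -- … and conversely the path exists (by induction on a bound n for j - i).
    upath-complete : EM → (n : ℕ) → ∀ {i j} → j ≤ n + i → i ≤ j →
                     (∀ m → OnUPath i j m → P m) → UPath w P j i
    upath-complete em zero j≤i i≤j _ = subst (UPath w P _) (≤-antisym j≤i i≤j) u-done
    upath-complete em (suc n) {i} {j} j≤n+i i≤j H with m≤n⇒m<n∨m≡n i≤j
    ... | inj₂ refl = u-done
    ... | inj₁ i<j with next-step em j i
    ...   | p' , st = u-step i<j (H i (≤-refl , i<j , not-covered-self)) st
                        (upath-complete em n j≤n+p' (step-≤ st i<j) H')
      where
      j≤n+p' : j ≤ n + p'
      j≤n+p' = ≤-trans j≤n+i (≤-trans (≤-reflexive (sym (+-suc n i))) (+-monoʳ-≤ n (step-< st)))
      H' : ∀ m → OnUPath p' j m → P m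
      H' m (p'≤m , m<j , uncovered) =
        H m (≤-trans (<⇒≤ (step-< st)) p'≤m , m<j , uncovered ∘ step-shift st p'≤m)

    upath-char : EM → ∀ {i j} → i ≤ j → UPath w P j i ⇔ (∀ m → OnUPath i j m → P m)
    upath-char em {i} {j} i≤j = mk⇔ upath-sound (upath-complete em j (m≤m+n j i) i≤j)

    spath-sound : ∀ {i j} → SPath w P i j → ∀ m → OnSPath j i m → P m
    spath-sound s-done m (j<m , m≤j , _) = ⊥-elim (<⇒≱ j<m m≤j)
    spath-sound (s-step {p} {p'} _ st Pp' rest) m (p<m , m≤i , uncovered) with <-cmp m p'
    ... | tri< m<p' _ _ = ⊥-elim (uncovered (step-skips st p<m m<p'))
    ... | tri≈ _ refl _ = Pp'
    ... | tri> _ _ p'<m = spath-sound rest m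
                            (p'<m , m≤i , uncovered ∘ covered-weaken (<⇒≤ (step-< st)))

    spath-complete : EM → (n : ℕ) → ∀ {j i} → i ≤ n + j → j ≤ i →
                     (∀ m → OnSPath j i m → P m) → SPath w P i j
    spath-complete em zero i≤j j≤i _ = subst (SPath w P _) (≤-antisym i≤j j≤i) s-done
    spath-complete em (suc n) {j} {i} i≤n+j j≤i H with m≤n⇒m<n∨m≡n j≤i
    ... | inj₂ refl = s-done
    ... | inj₁ j<i with next-step em i j
    ...   | p' , st = s-step j<i st
                        (H p' (step-< st , step-≤ st j<i , not-covered-self ∘ step-shift st ≤-refl))
                        (spath-complete em n i≤n+p' (step-≤ st j<i) H')
      where
      i≤n+p' : i ≤ n + p'
      i≤n+p' = ≤-trans i≤n+j (≤-trans (≤-reflexive (sym (+-suc n j))) (+-monoʳ-≤ n (step-< st)))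
      H' : ∀ m → OnSPath p' i m → P m
      H' m (p'<m , m≤i , uncovered) =
        H m (<-trans (step-< st) p'<m , m≤i , uncovered ∘ step-shift st (<⇒≤ p'<m))

    spath-char : EM → ∀ {j i} → j ≤ i → SPath w P i j ⇔ (∀ m → OnSPath j i m → P m)
    spath-char em {j} {i} j≤i = mk⇔ spath-sound (spath-complete em i (m≤m+n i j) j≤i)

module _ {k : ℕ} where

  infixr 5 _∧ᶠ_
  infixr 4 _⇒ᶠ_

  _∧ᶠ_ : FO3 k → FO3 k → FO3 k
  α ∧ᶠ β = ¬ᶠ ((¬ᶠ α) ∨ᶠ (¬ᶠ β))

  _⇒ᶠ_ : FO3 k → FO3 k → FO3 k
  α ⇒ᶠ β = (¬ᶠ α) ∨ᶠ β

  ∀ᶠ : Var → FO3 k → FO3 k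
  ∀ᶠ v α = ¬ᶠ (∃ᶠ v (¬ᶠ α))

  _≼_ : Var → Var → FO3 k
  u ≼ v = (u ≺ v) ∨ᶠ (u ≐ v)

  ren : (Var → Var) → FO3 k → FO3 k
  ren σ (P a v)   = P a (σ v)
  ren σ (u ≐ v)   = σ u ≐ σ v
  ren σ (u ≺ v)   = σ u ≺ σ v
  ren σ (μ' u v)  = μ' (σ u) (σ v)
  ren σ (call' v) = call' (σ v)
  ren σ (ret' v)  = ret' (σ v)
  ren σ (¬ᶠ α)    = ¬ᶠ ren σ α
  ren σ (α ∨ᶠ β)  = ren σ α ∨ᶠ ren σ β
  ren σ (∃ᶠ v α)  = ∃ᶠ (σ v) (ren σ α)

swapXY swapXZ : Var → Var
swapXY = transpose x y
swapXZ = transpose x z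

transpose-injective : ∀ {n} (i j : Fin n) → Injective _≡_ _≡_ (transpose i j)
transpose-injective i j {a} {b} eq =
  trans (sym (transpose-inverse j i)) (trans (cong (transpose j i) eq) (transpose-inverse j i))

module Renaming {k} (w : NestedWord k) where

  upd-cong : ∀ {ρ₁ ρ₂ : Env} → (∀ u → ρ₁ u ≡ ρ₂ u) → ∀ v m u → (ρ₁ [ v ≔ m ]) u ≡ (ρ₂ [ v ≔ m ]) u
  upd-cong e v m u with u ≟ v
  ... | yes _ = refl
  ... | no _  = e u

  sat-ext : ∀ (α : FO3 k) {ρ₁ ρ₂ : Env} → (∀ u → ρ₁ u ≡ ρ₂ u) → w ⊨ᶠ α [ ρ₁ ] → w ⊨ᶠ α [ ρ₂ ]
  sat-ext (P a v)   e h = subst (λ t → label w t ≡ a) (e v) h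
  sat-ext (u ≐ v)   e h = trans (sym (e u)) (trans h (e v))
  sat-ext (u ≺ v)   e h = subst₂ _<_ (e u) (e v) h
  sat-ext (μ' u v)  e h = subst₂ (μ w) (e u) (e v) h
  sat-ext (call' v) e h = subst (call w) (e v) h
  sat-ext (ret' v)  e h = subst (ret w) (e v) h
  sat-ext (¬ᶠ α)    e h = λ h' → h (sat-ext α (sym ∘ e) h')
  sat-ext (α ∨ᶠ β)  e (inj₁ h) = inj₁ (sat-ext α e h)
  sat-ext (α ∨ᶠ β)  e (inj₂ h) = inj₂ (sat-ext β e h)
  sat-ext (∃ᶠ v α)  e (m , pm , h) = m , pm , sat-ext α (upd-cong e v m) h

  module _ (σ : Var → Var) (σ-inj : Injective _≡_ _≡_ σ) where

    upd-ren : ∀ (ρ : Env) v m u → (ρ [ σ v ≔ m ]) (σ u) ≡ ((ρ ∘ σ) [ v ≔ m ]) u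
    upd-ren ρ v m u with σ u ≟ σ v | u ≟ v
    ... | yes _ | yes _  = refl
    ... | yes p | no u≢v = ⊥-elim (u≢v (σ-inj p))
    ... | no p  | yes q  = ⊥-elim (p (cong σ q))
    ... | no _  | no _   = refl

    ren-sem : ∀ (α : FO3 k) (ρ : Env) → (w ⊨ᶠ ren σ α [ ρ ]) ⇔ (w ⊨ᶠ α [ ρ ∘ σ ])
    ren-sem (P a v)   ρ = ⇔-id _
    ren-sem (u ≐ v)   ρ = ⇔-id _
    ren-sem (u ≺ v)   ρ = ⇔-id _
    ren-sem (μ' u v)  ρ = ⇔-id _
    ren-sem (call' v) ρ = ⇔-id _
    ren-sem (ret' v)  ρ = ⇔-id _
    ren-sem (¬ᶠ α)    ρ = ¬-cong-⇔ (ren-sem α ρ)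
    ren-sem (α ∨ᶠ β)  ρ = ren-sem α ρ ⊎-⇔ ren-sem β ρ
    ren-sem (∃ᶠ v α)  ρ = mk⇔
      (λ (m , pm , h) → m , pm , sat-ext α (upd-ren ρ v m) (to (ren-sem α (ρ [ σ v ≔ m ])) h))
      (λ (m , pm , h) → m , pm , from (ren-sem α (ρ [ σ v ≔ m ])) (sat-ext α (sym ∘ upd-ren ρ v m) h))

module _ {k : ℕ} where

  nextᶠ : FO3 k
  nextᶠ = (x ≺ y) ∧ᶠ ¬ᶠ ∃ᶠ z ((x ≺ z) ∧ᶠ (z ≺ y))

  prevᶠ : FO3 k
  prevᶠ = ren swapXY nextᶠ

  -- PendingCall x z  (the bound x is reused for the return)
  pendingCallᶠ : FO3 k
  pendingCallᶠ = ∃ᶠ y ((x ≼ y) ∧ᶠ (y ≺ z) ∧ᶠ ∃ᶠ x (μ' y x ∧ᶠ (z ≺ x)))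

  -- PendingReturn z y  (the bound y is reused for the call)
  pendingReturnᶠ : FO3 k
  pendingReturnᶠ = ∃ᶠ x ((z ≺ x) ∧ᶠ (x ≼ y) ∧ᶠ ∃ᶠ y (μ' y x ∧ᶠ (y ≺ z)))

  coveredᶠ : FO3 k
  coveredᶠ = pendingCallᶠ ∧ᶠ pendingReturnᶠ

  onUPathᶠ : FO3 k
  onUPathᶠ = (x ≼ z) ∧ᶠ (z ≺ y) ∧ᶠ ¬ᶠ coveredᶠ

  onSPathᶠ : FO3 k
  onSPathᶠ = (y ≺ z) ∧ᶠ (z ≼ x) ∧ᶠ ¬ᶠ ren swapXY coveredᶠ

  untilPathᶠ : FO3 k → FO3 k
  untilPathᶠ α = (x ≼ y) ∧ᶠ ∀ᶠ z (onUPathᶠ ⇒ᶠ ren swapXZ α)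

  sincePathᶠ : FO3 k → FO3 k
  sincePathᶠ α = (y ≼ x) ∧ᶠ ∀ᶠ z (onSPathᶠ ⇒ᶠ ren swapXZ α)

  tr : NWTL k → FO3 k
  tr ⊤'       = x ≐ x
  tr (lab a)  = P a x
  tr callF    = call' x
  tr retF     = ret' x
  tr (¬' φ)   = ¬ᶠ tr φ
  tr (φ ∨' ψ) = tr φ ∨ᶠ tr ψ
  tr (○ φ)    = ∃ᶠ y (nextᶠ ∧ᶠ ren swapXY (tr φ))
  tr (○μ φ)   = ∃ᶠ y (μ' x y ∧ᶠ ren swapXY (tr φ))
  tr (⊖ φ)    = ∃ᶠ y (prevᶠ ∧ᶠ ren swapXY (tr φ))
  tr (⊖μ φ)   = ∃ᶠ y (μ' y x ∧ᶠ ren swapXY (tr φ))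
  tr (φ U ψ)  = ∃ᶠ y (untilPathᶠ (tr φ) ∧ᶠ ren swapXY (tr ψ))
  tr (φ S ψ)  = ∃ᶠ y (sincePathᶠ (tr φ) ∧ᶠ ren swapXY (tr ψ))

module Correctness (em : EM) {k} (w : NestedWord k) where
  open Classical em
  open Nesting w
  open Renaming w

  AllPos : Env → Set
  AllPos ρ = ∀ v → Pos w (ρ v)

  upd-pos : ∀ {ρ} → AllPos ρ → ∀ v {m} → Pos w m → AllPos (ρ [ v ≔ m ])
  upd-pos ap v pm u with u ≟ v
  ... | yes _ = pm
  ... | no _  = ap u

  ≼-sem : ∀ {a b : ℕ} → (a < b ⊎ a ≡ b) ⇔ (a ≤ b)
  ≼-sem = mk⇔ [ <⇒≤ , ≤-reflexive ] m≤n⇒m<n∨m≡n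

  -- x + 1 lies between the positions x and y when x < y, hence AllPos
  nextᶠ-sem : ∀ ρ → AllPos ρ → (w ⊨ᶠ nextᶠ [ ρ ]) ⇔ (suc (ρ x) ≡ ρ y)
  nextᶠ-sem ρ ap = mk⇔ successor adjacent
    where
    successor : w ⊨ᶠ nextᶠ [ ρ ] → suc (ρ x) ≡ ρ y
    successor h with to ∧-classical h
    ... | x<y , nothing-between with m≤n⇒m<n∨m≡n x<y
    ...   | inj₂ eq = eq
    ...   | inj₁ sx<y = ⊥-elim (nothing-between
            (suc (ρ x) , pos-below (ap y) (s≤s z≤n) (<⇒≤ sx<y) ,
             from ∧-classical (≤-refl , sx<y)))
    adjacent : suc (ρ x) ≡ ρ y → w ⊨ᶠ nextᶠ [ ρ ]
    adjacent sx≡y = from ∧-classical (≤-reflexive sx≡y , λ (m , _ , h) →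
      let (x<m , m<y) = to ∧-classical h in <⇒≱ (subst (m <_) (sym sx≡y) m<y) x<m)

  prevᶠ-sem : ∀ ρ → AllPos ρ → (w ⊨ᶠ prevᶠ [ ρ ]) ⇔ (suc (ρ y) ≡ ρ x)
  prevᶠ-sem ρ ap = nextᶠ-sem (ρ ∘ swapXY) (ap ∘ swapXY) ⇔-∘ ren-sem swapXY (transpose-injective x y) nextᶠ ρ

  pendingCallᶠ-sem : ∀ ρ → (w ⊨ᶠ pendingCallᶠ [ ρ ]) ⇔ PendingCall (ρ x) (ρ z)
  pendingCallᶠ-sem ρ = mk⇔ unpack pack
    where
    unpack : w ⊨ᶠ pendingCallᶠ [ ρ ] → PendingCall (ρ x) (ρ z)
    unpack (c , _ , h) =
      let (x≤c , h₁) = to ∧-classical h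
          (c<z , r , _ , h₂) = to ∧-classical h₁
          (mcr , z<r) = to ∧-classical h₂
      in c , to ≼-sem x≤c , c<z , r , mcr , z<r
    pack : PendingCall (ρ x) (ρ z) → w ⊨ᶠ pendingCallᶠ [ ρ ]
    pack (c , x≤c , c<z , r , mcr , z<r) =
      c , proj₁ (μ-dom w mcr) , from ∧-classical (from ≼-sem x≤c , from ∧-classical
        (c<z , r , proj₂ (μ-dom w mcr) , from ∧-classical (mcr , z<r)))

  pendingReturnᶠ-sem : ∀ ρ → (w ⊨ᶠ pendingReturnᶠ [ ρ ]) ⇔ PendingReturn (ρ z) (ρ y)
  pendingReturnᶠ-sem ρ = mk⇔ unpack pack
    where
    unpack : w ⊨ᶠ pendingReturnᶠ [ ρ ] → PendingReturn (ρ z) (ρ y)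
    unpack (r , _ , h) =
      let (z<r , h₁) = to ∧-classical h
          (r≤y , c , _ , h₂) = to ∧-classical h₁
          (mcr , c<z) = to ∧-classical h₂
      in r , z<r , to ≼-sem r≤y , c , mcr , c<z
    pack : PendingReturn (ρ z) (ρ y) → w ⊨ᶠ pendingReturnᶠ [ ρ ]
    pack (r , z<r , r≤y , c , mcr , c<z) =
      r , proj₂ (μ-dom w mcr) , from ∧-classical (z<r , from ∧-classical
        (from ≼-sem r≤y , c , proj₁ (μ-dom w mcr) , from ∧-classical (mcr , c<z)))

  coveredᶠ-sem : ∀ ρ → (w ⊨ᶠ coveredᶠ [ ρ ]) ⇔ Covered (ρ x) (ρ z) (ρ y)
  coveredᶠ-sem ρ = ⇔-sym covered-split ⇔-∘ ((pendingCallᶠ-sem ρ ×-⇔ pendingReturnᶠ-sem ρ) ⇔-∘ ∧-classical)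

  onUPathᶠ-sem : ∀ ρ → (w ⊨ᶠ onUPathᶠ [ ρ ]) ⇔ OnUPath (ρ x) (ρ y) (ρ z)
  onUPathᶠ-sem ρ =
    (≼-sem ×-⇔ ((⇔-id _ ×-⇔ ¬-cong-⇔ (coveredᶠ-sem ρ)) ⇔-∘ ∧-classical)) ⇔-∘ ∧-classical

  onSPathᶠ-sem : ∀ ρ → (w ⊨ᶠ onSPathᶠ [ ρ ]) ⇔ OnSPath (ρ y) (ρ x) (ρ z)
  onSPathᶠ-sem ρ =
    (⇔-id _ ×-⇔ ((≼-sem ×-⇔ ¬-cong-⇔ swapped-covered) ⇔-∘ ∧-classical)) ⇔-∘ ∧-classical
    where
    swapped-covered : (w ⊨ᶠ ren swapXY coveredᶠ [ ρ ]) ⇔ Covered (ρ y) (ρ z) (ρ x)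
    swapped-covered = coveredᶠ-sem (ρ ∘ swapXY) ⇔-∘ ren-sem swapXY (transpose-injective x y) coveredᶠ ρ

  Correct : NWTL k → Set
  Correct φ = ∀ ρ → AllPos ρ → (w , ρ x ⊨ φ) ⇔ (w ⊨ᶠ tr φ [ ρ ])

  moved : ∀ {φ} → Correct φ → (σ : Var → Var) → Injective _≡_ _≡_ σ → ∀ ρ → AllPos ρ →
          (w , ρ (σ x) ⊨ φ) ⇔ (w ⊨ᶠ ren σ (tr φ) [ ρ ])
  moved {φ} IH σ σ-inj ρ ap = ⇔-sym (ren-sem σ σ-inj (tr φ) ρ) ⇔-∘ IH (ρ ∘ σ) (ap ∘ σ)

  at-y : ∀ {φ} → Correct φ → ∀ ρ → AllPos ρ → ∀ {m} → Pos w m →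
         (w , m ⊨ φ) ⇔ (w ⊨ᶠ ren swapXY (tr φ) [ ρ [ y ≔ m ] ])
  at-y {φ} IH ρ ap {m} pm = moved {φ} IH swapXY (transpose-injective x y) (ρ [ y ≔ m ]) (upd-pos ap y pm)

  guarded-∀ : ∀ {φ} → Correct φ → (γ : FO3 k) → ∀ ρ → AllPos ρ → {G : ℕ → Set} →
              (∀ m → (w ⊨ᶠ γ [ ρ [ z ≔ m ] ]) ⇔ G m) → (∀ m → G m → Pos w m) →
              (w ⊨ᶠ ∀ᶠ z (γ ⇒ᶠ ren swapXZ (tr φ)) [ ρ ]) ⇔ (∀ m → G m → (w , m ⊨ φ))
  guarded-∀ {φ} IH γ ρ ap γ-sem G-pos = mk⇔
    (λ h m g → let pm = G-pos m g in
      from (at-z pm) (to ⇒-classical (to ∀-classical h m pm) (from (γ-sem m) g)))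
    (λ f → from ∀-classical (λ m pm → from ⇒-classical (λ hγ → to (at-z pm) (f m (to (γ-sem m) hγ)))))
    where
    at-z : ∀ {m} → Pos w m → (w , m ⊨ φ) ⇔ (w ⊨ᶠ ren swapXZ (tr φ) [ ρ [ z ≔ m ] ])
    at-z {m} pm = moved {φ} IH swapXZ (transpose-injective x z) (ρ [ z ≔ m ]) (upd-pos ap z pm)

  witnessed-∃ : ∀ {φ} → Correct φ → (β : FO3 k) → ∀ ρ → AllPos ρ → {R : ℕ → Set} →
                (∀ {m} → Pos w m → (w ⊨ᶠ β [ ρ [ y ≔ m ] ]) ⇔ R m) →
                (w ⊨ᶠ ∃ᶠ y (β ∧ᶠ ren swapXY (tr φ)) [ ρ ]) ⇔ Σ ℕ (λ m → Pos w m × R m × (w , m ⊨ φ))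
  witnessed-∃ {φ} IH β ρ ap β-sem = mk⇔
    (λ (m , pm , h) → let (hβ , hφ) = to ∧-classical h in
      m , pm , to (β-sem pm) hβ , from (at-y {φ} IH ρ ap pm) hφ)
    (λ (m , pm , r , hφ) → m , pm , from ∧-classical (from (β-sem pm) r , to (at-y {φ} IH ρ ap pm) hφ))

  next-correct : ∀ {φ} → Correct φ → Correct (○ φ)
  next-correct {φ} IH ρ ap = ⇔-sym (witnessed-∃ {φ} IH nextᶠ ρ ap (λ pm → nextᶠ-sem _ (upd-pos ap y pm)))
    ⇔-∘ mk⇔ (λ (ps , h) → _ , ps , refl , h) (λ { (_ , pm , refl , h) → pm , h })

  prev-correct : ∀ {φ} → Correct φ → Correct (⊖ φ)
  prev-correct {φ} IH ρ ap = ⇔-sym (witnessed-∃ {φ} IH prevᶠ ρ ap (λ pm → prevᶠ-sem _ (upd-pos ap y pm)))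
    ⇔-∘ mk⇔ forward backward
    where
    forward : (w , ρ x ⊨ (⊖ φ)) → Σ ℕ (λ m → Pos w m × (suc m ≡ ρ x) × (w , m ⊨ φ))
    forward (1<i , h) = ρ x ∸ 1 , pos-below (ap x) (∸-monoˡ-≤ 1 1<i) (m∸n≤m (ρ x) 1) ,
      suc-pred (ρ x) {{>-nonZero (pos-≥1 _ (ap x))}} , h
    backward : Σ ℕ (λ m → Pos w m × (suc m ≡ ρ x) × (w , m ⊨ φ)) → (w , ρ x ⊨ (⊖ φ))
    backward (m , pm , sm≡i , h) =
      subst (1 <_) sm≡i (s≤s (pos-≥1 _ pm)) , subst (λ t → w , t ⊨ φ) (cong (_∸ 1) sm≡i) h

  matched-correct : ∀ {φ} → Correct φ → Correct (○μ φ)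
  matched-correct {φ} IH ρ ap = ⇔-sym (witnessed-∃ {φ} IH (μ' x y) ρ ap (λ _ → ⇔-id _))
    ⇔-∘ mk⇔ (λ (j , mij , h) → j , proj₂ (μ-dom w mij) , mij , h) (λ (j , _ , mij , h) → j , mij , h)

  matched-back-correct : ∀ {φ} → Correct φ → Correct (⊖μ φ)
  matched-back-correct {φ} IH ρ ap = ⇔-sym (witnessed-∃ {φ} IH (μ' y x) ρ ap (λ _ → ⇔-id _))
    ⇔-∘ mk⇔ (λ (j , mji , h) → j , proj₁ (μ-dom w mji) , mji , h) (λ (j , _ , mji , h) → j , mji , h)

  untilPathᶠ-sem : ∀ {φ} → Correct φ → ∀ ρ → AllPos ρ → ∀ {j} → Pos w j →
    (w ⊨ᶠ untilPathᶠ (tr φ) [ ρ [ y ≔ j ] ]) ⇔ Σ (ρ x ≤ j) (λ _ → UPath w (w ,_⊨ φ) j (ρ x))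
  untilPathᶠ-sem {φ} IH ρ ap {j} pj = mk⇔
    (λ h → let (x≤y , h∀) = to ∧-classical h; i≤j = to ≼-sem x≤y in
      i≤j , from (upath-char (w ,_⊨ φ) em i≤j) (to nodes h∀))
    (λ (i≤j , path) → from ∧-classical (from ≼-sem i≤j , from nodes (to (upath-char (w ,_⊨ φ) em i≤j) path)))
    where
    nodes : (w ⊨ᶠ ∀ᶠ z (onUPathᶠ ⇒ᶠ ren swapXZ (tr φ)) [ ρ [ y ≔ j ] ]) ⇔
            (∀ m → OnUPath (ρ x) j m → (w , m ⊨ φ))
    nodes = guarded-∀ {φ} IH onUPathᶠ (ρ [ y ≔ j ]) (upd-pos ap y pj)
              (λ m → onUPathᶠ-sem (ρ [ y ≔ j ] [ z ≔ m ]))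
              (λ m (i≤m , m<j , _) → pos-below pj (≤-trans (pos-≥1 _ (ap x)) i≤m) (<⇒≤ m<j))

  sincePathᶠ-sem : ∀ {φ} → Correct φ → ∀ ρ → AllPos ρ → ∀ {j} → Pos w j →
    (w ⊨ᶠ sincePathᶠ (tr φ) [ ρ [ y ≔ j ] ]) ⇔ Σ (j ≤ ρ x) (λ _ → SPath w (w ,_⊨ φ) (ρ x) j)
  sincePathᶠ-sem {φ} IH ρ ap {j} pj = mk⇔
    (λ h → let (y≤x , h∀) = to ∧-classical h; j≤i = to ≼-sem y≤x in
      j≤i , from (spath-char (w ,_⊨ φ) em j≤i) (to nodes h∀))
    (λ (j≤i , path) → from ∧-classical (from ≼-sem j≤i , from nodes (to (spath-char (w ,_⊨ φ) em j≤i) path)))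
    where
    nodes : (w ⊨ᶠ ∀ᶠ z (onSPathᶠ ⇒ᶠ ren swapXZ (tr φ)) [ ρ [ y ≔ j ] ]) ⇔
            (∀ m → OnSPath j (ρ x) m → (w , m ⊨ φ))
    nodes = guarded-∀ {φ} IH onSPathᶠ (ρ [ y ≔ j ]) (upd-pos ap y pj)
              (λ m → onSPathᶠ-sem (ρ [ y ≔ j ] [ z ≔ m ]))
              (λ m (j<m , m≤i , _) → pos-below (ap x) (≤-trans (pos-≥1 _ pj) (<⇒≤ j<m)) m≤i)

  until-correct : ∀ {φ ψ} → Correct φ → Correct ψ → Correct (φ U ψ)
  until-correct {φ} {ψ} IHφ IHψ ρ ap =
    ⇔-sym (witnessed-∃ {ψ} IHψ (untilPathᶠ (tr φ)) ρ ap (untilPathᶠ-sem {φ} IHφ ρ ap)) ⇔-∘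
    mk⇔ (λ (j , i≤j , pj , hψ , path) → j , pj , (i≤j , path) , hψ)
        (λ (j , pj , (i≤j , path) , hψ) → j , i≤j , pj , hψ , path)

  since-correct : ∀ {φ ψ} → Correct φ → Correct ψ → Correct (φ S ψ)
  since-correct {φ} {ψ} IHφ IHψ ρ ap =
    ⇔-sym (witnessed-∃ {ψ} IHψ (sincePathᶠ (tr φ)) ρ ap (sincePathᶠ-sem {φ} IHφ ρ ap)) ⇔-∘
    mk⇔ (λ (j , j≤i , pj , hψ , path) → j , pj , (j≤i , path) , hψ)
        (λ (j , pj , (j≤i , path) , hψ) → j , j≤i , pj , hψ , path)

  correct : ∀ φ → Correct φ
  correct ⊤'       ρ ap = mk⇔ (λ _ → refl) (λ _ → tt)
  correct (lab a)  ρ ap = ⇔-id _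
  correct callF    ρ ap = ⇔-id _
  correct retF     ρ ap = ⇔-id _
  correct (¬' φ)   ρ ap = ¬-cong-⇔ (correct φ ρ ap)
  correct (φ ∨' ψ) ρ ap = correct φ ρ ap ⊎-⇔ correct ψ ρ ap
  correct (○ φ)    = next-correct {φ} (correct φ)
  correct (○μ φ)   = matched-correct {φ} (correct φ)
  correct (⊖ φ)    = prev-correct {φ} (correct φ)
  correct (⊖μ φ)   = matched-back-correct {φ} (correct φ)
  correct (φ U ψ)  = until-correct {φ} {ψ} (correct φ) (correct ψ)
  correct (φ S ψ)  = since-correct {φ} {ψ} (correct φ) (correct ψ)

lemma4p2 : (k : ℕ) (φ : NWTL k) →
    Σ (FO3 k) (λ α → ExcludedMiddle 0ℓ →
      (w : NestedWord k) (i : ℕ) → Pos w i →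
      (ρ : Env) → ρ x ≡ i → (∀ v → Pos w (ρ v)) →
      ((w , i ⊨ φ) ⇔ (w ⊨ᶠ α [ ρ ])))
lemma4p2 k φ = tr φ , λ { em w _ _ ρ refl ap → Correctness.correct em w φ ρ ap }
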